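{- Let $(A,\wedge,\vee,\Rightarrow,\neg,\sim,0,1)$ be a symmetrical Heyting algebra. Let $Ob$ be the set of all prime filters of $A$, ordered by $R={\subseteq}$, let $\varphi:Ob\to Ob$ be $\varphi(P)=A\setminus\{\sim p: p\in P\}$, and let $\mathcal O_R$ with operations $\cap,\cup,\Rightarrow,\dot-,\neg,\sim,\emptyset,Ob$ be as described in the context. Then there exists an injective map $h:A\to\mathcal O_R$ such that for all $a,b\in A$: $h(0)=\emptyset$, $h(1)=Ob$, $h(a\wedge b)=h(a)\cap h(b)$, $h(a\vee b)=h(a)\cup h(b)$, $h(a\Rightarrow b)=h(a)\Rightarrow h(b)$, $h(\neg a)=\neg h(a)$ and $h(\sim a)=\sim h(a)$.
   Context: A symmetrical Heyting algebra is a Heyting algebra $(A,\wedge,\vee,\Rightarrow,\neg,0,1)$ (with $\neg a=a\Rightarrow 0$) with a unary operation $\sim$ satisfying $\sim\sim x=x$ and $\sim(x\wedge y)=\sim x\vee\sim y$. A prime filter is a proper filter $P$ such that $a\vee b\in P$ implies $a\in P$ or $b\in P$; $\varphi(P)$ is again a prime filter and $\varphi(\varphi(P))=P$. For $P\in Ob$ let $R(P)=\{Q\in Ob: P\subseteq Q\}$; for $X\subseteq Ob$ put $C_RX=\bigcup\{R(P):P\in X\}$, $I_RX=\bigcup\{R(P): P\in Ob,\ R(P)\subseteq X\}$, $\varphi(X)=\{\varphi(P):P\in X\}$, $\sim X=Ob\setminus\varphi(X)$, and $\mathcal O_R=\{X\subseteq Ob: I_RX=X\}$. On $\mathcal O_R$: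 $G\Rightarrow H=I_R((Ob\setminus G)\cup H)$, $G\,\dot-\,H=C_R(G\cap(Ob\setminus H))$, $\neg G=G\Rightarrow\emptyset$; $\mathcal O_R$ is closed under $\sim$. -}

module Defs where

open import Level using (Level; _⊔_; suc; Lift)
open import Data.Product using (Σ; ∃; _×_; _,_)
open import Data.Sum using (_⊎_)
open import Data.Empty using (⊥)
open import Data.Unit using (⊤)
open import Relation.Nullary using (¬_)
open import Relation.Binary.Lattice using (HeytingAlgebra)

Zorn : (ℓ : Level) → Set (suc ℓ)
Zorn ℓ = (T : Set ℓ) (_≤_ : T → T → Set ℓ) →
  (∀ x → x ≤ x) →
  (∀ x y z → x ≤ y → y ≤ z → x ≤ z) →
  ((C : T → Set ℓ) →
     (∀ x y → C x → C y → (x ≤ y) ⊎ (y ≤ x)) →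
     Σ T (λ u → ∀ x → C x → x ≤ u)) →
  Σ T (λ m → ∀ y → m ≤ y → y ≤ m)

record SymHeytingAlgebra (c ℓ₁ ℓ₂ : Level) : Set (suc (c ⊔ ℓ₁ ⊔ ℓ₂)) where
  field
    heyting : HeytingAlgebra c ℓ₁ ℓ₂
  open HeytingAlgebra heyting public renaming (⊥ to 𝟘; ⊤ to 𝟙)
  field
    ∼_      : Carrier → Carrier
    ∼-cong  : ∀ {x y} → x ≈ y → (∼ x) ≈ (∼ y)
    ∼∼      : ∀ x → (∼ (∼ x)) ≈ x
    ∼-∧     : ∀ x y → (∼ (x ∧ y)) ≈ ((∼ x) ∨ (∼ y))

  ¬ₕ_ : Carrier → Carrier
  ¬ₕ x = x ⇨ 𝟘

module Representation {c ℓ₁ ℓ₂ : Level} (A : SymHeytingAlgebra c ℓ₁ ℓ₂) where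
  open SymHeytingAlgebra A

  a : Level
  a = c ⊔ ℓ₁ ⊔ ℓ₂

  PredA : Set (suc a)
  PredA = Carrier → Set a

  record IsPrimeFilter (P : PredA) : Set a where
    field
      has-𝟙    : P 𝟙
      up-close : ∀ x y → P x → x ≤ y → P y
      ∧-close  : ∀ x y → P x → P y → P (x ∧ y)
      proper   : ¬ (∀ x → P x)
      prime    : ∀ x y → P (x ∨ y) → P x ⊎ P y

  record Ob : Set (suc a) where
    constructor mkOb
    field
      pred  : PredA
      isPF  : IsPrimeFilter pred
  open Ob public

  _⊆ₒ_ : Ob → Ob → Set a
  P ⊆ₒ Q = ∀ x → pred P x → pred Q x

  _≐ₒ_ : Ob → Ob → Set a
  P ≐ₒ Q = ∀ x → (pred P x → pred Q x) × (pred Q x → pred P x)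

  φ-pred : Ob → PredA
  φ-pred P x = ¬ (Σ Carrier (λ p → pred P p × (x ≈ (∼ p))))

  Sub : Set (suc (suc a))
  Sub = Ob → Set (suc a)

  _≐_ : Sub → Sub → Set (suc a)
  X ≐ Y = ∀ P → (X P → Y P) × (Y P → X P)

  R : Ob → Sub
  R P Q = Lift (suc a) (P ⊆ₒ Q)

  C-R : Sub → Sub
  C-R X Q = Σ Ob (λ P → X P × R P Q)

  I-R : Sub → Sub
  I-R X Q = Σ Ob (λ P → (∀ Q' → R P Q' → X Q') × R P Q)

  φ-Sub : Sub → Sub
  φ-Sub X Q = Σ Ob (λ P → X P × (∀ x → (pred Q x → φ-pred P x) × (φ-pred P x → pred Q x)))

  ∅ : Sub
  ∅ _ = Lift (suc a) ⊥

  Whole : Sub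
  Whole _ = Lift (suc a) ⊤

  _∩_ : Sub → Sub → Sub
  (X ∩ Y) P = X P × Y P

  _∪_ : Sub → Sub → Sub
  (X ∪ Y) P = X P ⊎ Y P

  co : Sub → Sub
  co X P = ¬ X P

  ∼S_ : Sub → Sub
  ∼S X = co (φ-Sub X)

  _⇒S_ : Sub → Sub → Sub
  G ⇒S H = I-R (co G ∪ H)

  _∸S_ : Sub → Sub → Sub
  G ∸S H = C-R (G ∩ co H)

  ¬S_ : Sub → Sub
  ¬S G = G ⇒S ∅

  InO : Sub → Set (suc (suc a))
  InO X = Lift (suc (suc a)) (I-R X ≐ X)

  Representable : Set (suc (suc a))
  Representable =
    Σ (Carrier → Sub) λ h →
      (∀ x → InO (h x)) ×
      (∀ x y → h x ≐ h y → x ≈ y) ×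
      (h 𝟘 ≐ ∅) ×
      (h 𝟙 ≐ Whole) ×
      (∀ x y → h (x ∧ y) ≐ (h x ∩ h y)) ×
      (∀ x y → h (x ∨ y) ≐ (h x ∪ h y)) ×
      (∀ x y → h (x ⇨ y) ≐ (h x ⇒S h y)) ×
      (∀ x → h (¬ₕ x) ≐ (¬S (h x))) ×
      (∀ x → h (∼ x) ≐ (∼S (h x)))

-- The representing map sends a to h(a) = {P ∈ Ob : a ∈ P}.  Zorn
--     yields a filter maximal among those extending F and omitting y, and
--     any such maximal filter is prime.  The consequence used below is:
--     if x ⇨ y ∉ F then some prime filter Q ⊇ F has x ∈ Q and y ∉ Q.
--   * The representation: h(a) is R-open; ∧, ∨, 0, 1 are preserved by the
--     defining properties of prime filters; ⇨ (hence ¬) and injectivity by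
--     the separation consequence above; ∼ because φ(P) = {z : ∼z ∉ P} is a
--     prime filter with φ(φ(P)) = P.
module Submission where

open import Defs
open import Level using (Level; _⊔_; suc; Lift; lift; lower)
open import Axiom.ExcludedMiddle using (ExcludedMiddle)
open import Data.Product using (Σ; _×_; _,_; proj₁; proj₂)
open import Data.Sum using (_⊎_; inj₁; inj₂; [_,_]) renaming (map to ⊎-map)
open import Data.Maybe using (Maybe; nothing; just)
open import Data.Empty using (⊥; ⊥-elim)
open import Data.Unit using (⊤; tt)
open import Relation.Nullary using (¬_; Dec; yes; no)
open import Relation.Nullary.Decidable using (map′; decidable-stable)
open import Relation.Binary.Lattice using (HeytingAlgebra)
import Relation.Binary.Lattice.Properties.HeytingAlgebra as HeytingProperties
import Relation.Binary.Lattice.Properties.MeetSemilattice as MeetProperties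

module Classical {ℓ : Level} (em : ExcludedMiddle (suc ℓ)) where

  decide : (Q : Set ℓ) → Dec Q
  decide Q = map′ lower lift (em {Lift (suc ℓ) Q})

  by-contradiction : {Q : Set ℓ} → ¬ ¬ Q → Q
  by-contradiction {Q} = decidable-stable (decide Q)

  -- Propositional resizing: ‖ Q ‖ is a copy of Q one universe lower.  It is
  -- needed to form the union of a chain of filters as a predicate on A.
  Resized : {Q : Set (suc ℓ)} → Dec Q → Set ℓ
  Resized (yes _) = Lift ℓ ⊤
  Resized (no _)  = Lift ℓ ⊥

  ‖_‖ : Set (suc ℓ) → Set ℓ
  ‖ Q ‖ = Resized (em {Q})

  resize : {Q : Set (suc ℓ)} → Q → ‖ Q ‖
  resize {Q} q with em {Q}
  ... | yes _  = lift tt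
  ... | no ¬q = ⊥-elim (¬q q)

  unresize : {Q : Set (suc ℓ)} → ‖ Q ‖ → Q
  unresize {Q} r with em {Q}
  ... | yes q = q
  ... | no _  = ⊥-elim (lower r)

module Filters {c ℓ₁ ℓ₂ : Level} (H : HeytingAlgebra c ℓ₁ ℓ₂) where
  open HeytingAlgebra H renaming (⊤ to 𝟙; ⊥ to 𝟘)
  open HeytingProperties H using (⇨-eval; ∧-distribˡ-∨-≤)
  open MeetProperties meetSemilattice using (∧-monotonic)

  Pred : Set (suc (c ⊔ ℓ₁ ⊔ ℓ₂))
  Pred = Carrier → Set (c ⊔ ℓ₁ ⊔ ℓ₂)

  _⊑_ : Pred → Pred → Set (c ⊔ ℓ₁ ⊔ ℓ₂)
  F ⊑ G = ∀ x → F x → G x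

  record IsFilter (F : Pred) : Set (c ⊔ ℓ₁ ⊔ ℓ₂) where
    field
      has-𝟙    : F 𝟙
      up-close : ∀ x y → F x → x ≤ y → F y
      ∧-close  : ∀ x y → F x → F y → F (x ∧ y)

  IsPrime : Pred → Set (c ⊔ ℓ₁ ⊔ ℓ₂)
  IsPrime F = ∀ x y → F (x ∨ y) → F x ⊎ F y

  ↑_ : Carrier → Pred
  (↑ u) z = Lift (c ⊔ ℓ₁ ⊔ ℓ₂) (u ≤ z)

  ↑-isFilter : ∀ u → IsFilter (↑ u)
  ↑-isFilter u = record
    { has-𝟙    = lift (maximum u)
    ; up-close = λ _ _ (lift u≤x) x≤y → lift (trans u≤x x≤y)
    ; ∧-close  = λ _ _ (lift u≤x) (lift u≤y) → lift (∧-greatest u≤x u≤y) }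

  _⊕_ : Pred → Carrier → Pred
  (F ⊕ u) z = Σ Carrier (λ m → F m × (m ∧ u) ≤ z)

  ⊑-⊕ : ∀ {F} u → F ⊑ (F ⊕ u)
  ⊑-⊕ u m m∈F = m , m∈F , x∧y≤x m u

  module _ {F : Pred} (isF : IsFilter F) where
    open IsFilter isF

    ⊕-isFilter : ∀ u → IsFilter (F ⊕ u)
    ⊕-isFilter u = record
      { has-𝟙    = 𝟙 , has-𝟙 , maximum _
      ; up-close = λ _ _ (m , m∈F , m∧u≤x) x≤y → m , m∈F , trans m∧u≤x x≤y
      ; ∧-close  = λ _ _ (m , m∈F , m∧u≤x) (n , n∈F , n∧u≤y) →
          m ∧ n , ∧-close m n m∈F n∈F ,
          ∧-greatest (trans (∧-monotonic (x∧y≤x m n) refl) m∧u≤x)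
                     (trans (∧-monotonic (x∧y≤y m n) refl) n∧u≤y) }

    ∈-⊕ : ∀ u → (F ⊕ u) u
    ∈-⊕ u = 𝟙 , has-𝟙 , x∧y≤y 𝟙 u

    ⊕-absorb : ∀ {u} → F u → (F ⊕ u) ⊑ F
    ⊕-absorb {u} u∈F z (m , m∈F , m∧u≤z) = up-close _ z (∧-close m u m∈F u∈F) m∧u≤z

    ⊕-⇨ : ∀ u y → (F ⊕ u) y → F (u ⇨ y)
    ⊕-⇨ u y (m , m∈F , m∧u≤y) = up-close m (u ⇨ y) m∈F (transpose-⇨ m∧u≤y)

    ⊕-∨ : ∀ u v y → (F ⊕ u) y → (F ⊕ v) y → (F ⊕ (u ∨ v)) y
    ⊕-∨ u v y (m , m∈F , m∧u≤y) (n , n∈F , n∧v≤y) =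
      m ∧ n , ∧-close m n m∈F n∈F ,
      trans (∧-distribˡ-∨-≤ (m ∧ n) u v)
            (∨-least (trans (∧-monotonic (x∧y≤x m n) refl) m∧u≤y)
                     (trans (∧-monotonic (x∧y≤y m n) refl) n∧v≤y))

  ⇨-modus-ponens : ∀ {F} → IsFilter F → ∀ u y → F (u ⇨ y) → F u → F y
  ⇨-modus-ponens isF u y u⇨y∈F u∈F =
    up-close _ y (∧-close (u ⇨ y) u u⇨y∈F u∈F) ⇨-eval
    where open IsFilter isF

module PrimeFilterTheorem {c ℓ₁ ℓ₂ : Level} (H : HeytingAlgebra c ℓ₁ ℓ₂)
  (em : ExcludedMiddle (suc (c ⊔ ℓ₁ ⊔ ℓ₂)))
  (zorn : Zorn (suc (c ⊔ ℓ₁ ⊔ ℓ₂))) where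

  open HeytingAlgebra H using (Carrier; _∧_; _∨_)
  open Filters H
  open Classical em

  -- A maximal filter omitting y is prime: if u, v ∉ M then y ∈ M ⊕ u and
  -- y ∈ M ⊕ v by maximality, so y ∈ M ⊕ (u ∨ v), which is M if u ∨ v ∈ M.
  maximal⇒prime : ∀ {M y} → IsFilter M → ¬ M y →
    (∀ G → IsFilter G → M ⊑ G → ¬ G y → G ⊑ M) → IsPrime M
  maximal⇒prime {M} {y} isM M∌y maximal u v uv∈M =
    by-contradiction λ u,v∉M →
      M∌y (⊕-absorb isM uv∈M y
        (⊕-∨ isM u v y (generates (λ u∈M → u,v∉M (inj₁ u∈M)))
                          (generates (λ v∈M → u,v∉M (inj₂ v∈M)))))
    where
      generates : ∀ {w} → ¬ M w → (M ⊕ w) y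
      generates {w} M∌w = by-contradiction λ y∉M⊕w →
        M∌w (maximal (M ⊕ w) (⊕-isFilter isM w) (⊑-⊕ w) y∉M⊕w w (∈-⊕ isM w))

  record Avoiding (F : Pred) (y : Carrier) : Set (suc (c ⊔ ℓ₁ ⊔ ℓ₂)) where
    field
      carrier  : Pred
      isFilter : IsFilter carrier
      extends  : F ⊑ carrier
      avoids   : ¬ carrier y
  open Avoiding

  _≤A_ : ∀ {F y} → Avoiding F y → Avoiding F y → Set (suc (c ⊔ ℓ₁ ⊔ ℓ₂))
  s ≤A t = Lift _ (carrier s ⊑ carrier t)

  module _ {F : Pred} (isF : IsFilter F) {y : Carrier} (F∌y : ¬ F y)
    (C : Avoiding F y → Set (suc (c ⊔ ℓ₁ ⊔ ℓ₂)))
    (chain : ∀ s t → C s → C t → (s ≤A t) ⊎ (t ≤A s)) where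

    Layer : Set (suc (c ⊔ ℓ₁ ⊔ ℓ₂))
    Layer = Maybe (Σ (Avoiding F y) C)

    layer : Layer → Avoiding F y
    layer nothing        = record
      { carrier = F ; isFilter = isF ; extends = λ _ z → z ; avoids = F∌y }
    layer (just (t , _)) = t

    layers-comparable : ∀ i j → (layer i ≤A layer j) ⊎ (layer j ≤A layer i)
    layers-comparable nothing  j        = inj₁ (lift (extends (layer j)))
    layers-comparable i        nothing  = inj₂ (lift (extends (layer i)))
    layers-comparable (just (s , s∈C)) (just (t , t∈C)) = chain s t s∈C t∈C

    ⋃ : Pred
    ⋃ z = ‖ Σ Layer (λ i → carrier (layer i) z) ‖

    ⋃-∧-close : ∀ x z → ⋃ x → ⋃ z → ⋃ (x ∧ z)
    ⋃-∧-close x z x∈⋃ z∈⋃ with unresize x∈⋃ | unresize z∈⋃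
    ... | i , x∈i | j , z∈j with layers-comparable i j
    ... | inj₁ (lift i⊑j) = resize (j , IsFilter.∧-close (isFilter (layer j)) x z (i⊑j x x∈i) z∈j)
    ... | inj₂ (lift j⊑i) = resize (i , IsFilter.∧-close (isFilter (layer i)) x z x∈i (j⊑i z z∈j))

    chain-bound : Σ (Avoiding F y) (λ U → ∀ t → C t → t ≤A U)
    chain-bound = record
      { carrier  = ⋃
      ; isFilter = record
        { has-𝟙    = resize (nothing , has-𝟙)
        ; up-close = λ x z x∈⋃ x≤z → let (i , x∈i) = unresize x∈⋃ in
            resize (i , IsFilter.up-close (isFilter (layer i)) x z x∈i x≤z)
        ; ∧-close  = ⋃-∧-close }
      ; extends  = λ z z∈F → resize (nothing , z∈F)
      ; avoids   = λ y∈⋃ → let (i , y∈i) = unresize y∈⋃ in avoids (layer i) y∈i }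
      , λ t t∈C → lift (λ z z∈t → resize (just (t , t∈C) , z∈t))
      where open IsFilter isF using (has-𝟙)

  prime-filter-theorem : ∀ {F} → IsFilter F → ∀ {y} → ¬ F y →
    Σ Pred (λ M → IsFilter M × IsPrime M × F ⊑ M × ¬ M y)
  prime-filter-theorem {F} isF {y} F∌y =
    carrier M , isFilter M ,
    maximal⇒prime (isFilter M) (avoids M) maximal , extends M , avoids M
    where
      zorn-max : Σ (Avoiding F y) (λ m → ∀ t → m ≤A t → t ≤A m)
      zorn-max = zorn (Avoiding F y) _≤A_ (λ _ → lift (λ _ z → z))
        (λ _ _ _ (lift s⊑t) (lift t⊑u) → lift (λ z z∈s → t⊑u z (s⊑t z z∈s)))
        (chain-bound isF F∌y)

      M : Avoiding F y
      M = proj₁ zorn-max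

      maximal : ∀ G → IsFilter G → carrier M ⊑ G → ¬ G y → G ⊑ carrier M
      maximal G isG M⊑G G∌y = lower (proj₂ zorn-max
        (record { carrier = G ; isFilter = isG
                ; extends = λ z z∈F → M⊑G z (extends M z z∈F) ; avoids = G∌y })
        (lift M⊑G))

module SymmetryLaws {c ℓ₁ ℓ₂ : Level} (A : SymHeytingAlgebra c ℓ₁ ℓ₂) where
  open SymHeytingAlgebra A

  ∼-antitone : ∀ {x y} → x ≤ y → (∼ y) ≤ (∼ x)
  ∼-antitone {x} {y} x≤y =
    trans (y≤x∨y (∼ x) (∼ y))
      (trans (reflexive (Eq.sym (∼-∧ x y)))
        (reflexive (∼-cong (antisym (x∧y≤x x y) (∧-greatest refl x≤y)))))

  ∼-galois : ∀ {x y} → x ≤ (∼ y) → y ≤ (∼ x)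
  ∼-galois {x} {y} x≤∼y = trans (reflexive (Eq.sym (∼∼ y))) (∼-antitone x≤∼y)

  ∼𝟙≤𝟘 : (∼ 𝟙) ≤ 𝟘
  ∼𝟙≤𝟘 = trans (∼-antitone (maximum (∼ 𝟘))) (reflexive (∼∼ 𝟘))

  𝟙≤∼𝟘 : 𝟙 ≤ (∼ 𝟘)
  𝟙≤∼𝟘 = ∼-galois (minimum (∼ 𝟙))

  ∼∧∼≤∼∨ : ∀ x y → ((∼ x) ∧ (∼ y)) ≤ (∼ (x ∨ y))
  ∼∧∼≤∼∨ x y = ∼-galois (∨-least (∼-galois (x∧y≤x (∼ x) (∼ y)))
                                 (∼-galois (x∧y≤y (∼ x) (∼ y))))

module Representation-Theorem {c ℓ₁ ℓ₂ : Level} (A : SymHeytingAlgebra c ℓ₁ ℓ₂)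
  (em : ExcludedMiddle (suc (c ⊔ ℓ₁ ⊔ ℓ₂)))
  (zorn : Zorn (suc (c ⊔ ℓ₁ ⊔ ℓ₂))) where

  open SymHeytingAlgebra A
  open Representation A
  open Filters heyting
  open PrimeFilterTheorem heyting em zorn using (prime-filter-theorem)
  open SymmetryLaws A
  open Classical em using (decide; by-contradiction)

  filter : (P : Ob) → IsFilter (pred P)
  filter P = record { has-𝟙 = has-𝟙 ; up-close = up-close ; ∧-close = ∧-close }
    where open IsPrimeFilter (isPF P)

  ∈-resp-≈ : (P : Ob) → ∀ {x y} → pred P x → x ≈ y → pred P y
  ∈-resp-≈ P x∈P x≈y = IsPrimeFilter.up-close (isPF P) _ _ x∈P (reflexive x≈y)

  𝟘∉ : (P : Ob) → ¬ pred P 𝟘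
  𝟘∉ P 𝟘∈P = proper (λ z → up-close 𝟘 z 𝟘∈P (minimum z))
    where open IsPrimeFilter (isPF P)

  separate-⇨ : ∀ {F} → IsFilter F → ∀ x y → ¬ F (x ⇨ y) →
    Σ Ob (λ Q → (F ⊑ pred Q) × pred Q x × ¬ pred Q y)
  separate-⇨ {F} isF x y F∌x⇨y
    with prime-filter-theorem (⊕-isFilter isF x) (λ y∈F⊕x → F∌x⇨y (⊕-⇨ isF x y y∈F⊕x))
  ... | M , isM , primeM , F⊕x⊑M , M∌y =
    mkOb M (record { has-𝟙 = IsFilter.has-𝟙 isM ; up-close = IsFilter.up-close isM
                   ; ∧-close = IsFilter.∧-close isM ; proper = λ all → M∌y (all y)
                   ; prime = primeM }) ,
    (λ z z∈F → F⊕x⊑M z (⊑-⊕ x z z∈F)) , F⊕x⊑M x (∈-⊕ isF x) , M∌y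

  h : Carrier → Sub
  h x P = Lift _ (pred P x)

  h-open : ∀ x → InO (h x)
  h-open x = lift λ P →
    (λ (P₀ , above-P₀⊆hx , lift P₀⊆P) → lift (P₀⊆P x (lower (above-P₀⊆hx P₀ (lift (λ _ z → z)))))) ,
    (λ x∈P → P , (λ Q (lift P⊆Q) → lift (P⊆Q x (lower x∈P))) , lift (λ _ z → z))

  -- h reflects the order: separate x from y starting from the filter ↑ 𝟙.
  h-reflects-≤ : ∀ x y → (∀ P → h x P → h y P) → x ≤ y
  h-reflects-≤ x y hx⊆hy = lower (by-contradiction {Lift (c ⊔ ℓ₁ ⊔ ℓ₂) (x ≤ y)} λ x≰y →
    let (Q , _ , x∈Q , y∉Q) = separate-⇨ (↑-isFilter 𝟙) x y
          (λ (lift 𝟙≤x⇨y) → x≰y (lift (trans (∧-greatest (maximum x) refl) (transpose-∧ 𝟙≤x⇨y))))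
    in y∉Q (lower (hx⊆hy Q (lift x∈Q))))

  h-injective : ∀ x y → h x ≐ h y → x ≈ y
  h-injective x y hx≐hy = antisym (h-reflects-≤ x y (λ P → proj₁ (hx≐hy P)))
                                  (h-reflects-≤ y x (λ P → proj₂ (hx≐hy P)))

  h-𝟘 : h 𝟘 ≐ ∅
  h-𝟘 P = (λ (lift 𝟘∈P) → ⊥-elim (𝟘∉ P 𝟘∈P)) , λ ()

  h-𝟙 : h 𝟙 ≐ Whole
  h-𝟙 P = (λ _ → lift tt) , (λ _ → lift (IsPrimeFilter.has-𝟙 (isPF P)))

  h-∧ : ∀ x y → h (x ∧ y) ≐ (h x ∩ h y)
  h-∧ x y P =
    (λ (lift x∧y∈P) → lift (up-close _ x x∧y∈P (x∧y≤x x y)) ,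
                      lift (up-close _ y x∧y∈P (x∧y≤y x y))) ,
    (λ (lift x∈P , lift y∈P) → lift (∧-close x y x∈P y∈P))
    where open IsPrimeFilter (isPF P)

  h-∨ : ∀ x y → h (x ∨ y) ≐ (h x ∪ h y)
  h-∨ x y P = forward , backward
    where
      open IsPrimeFilter (isPF P)

      forward : h (x ∨ y) P → (h x ∪ h y) P
      forward (lift x∨y∈P) = ⊎-map lift lift (prime x y x∨y∈P)

      backward : (h x ∪ h y) P → h (x ∨ y) P
      backward (inj₁ (lift x∈P)) = lift (up-close x _ x∈P (x≤x∨y x y))
      backward (inj₂ (lift y∈P)) = lift (up-close y _ y∈P (y≤x∨y x y))

  -- x ⇨ y ∈ P iff every prime filter above some P₀ ⊆ P containing x contains y;
  -- the nontrivial direction is separation applied to P₀.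
  h-⇨ : ∀ x y → h (x ⇨ y) ≐ (h x ⇒S h y)
  h-⇨ x y P = forward , backward
    where
      forward : h (x ⇨ y) P → (h x ⇒S h y) P
      forward (lift x⇨y∈P) = P , above-P , lift (λ _ z → z)
        where
          above-P : ∀ Q → R P Q → (co (h x) ∪ h y) Q
          above-P Q (lift P⊆Q) with decide (pred Q x)
          ... | no x∉Q  = inj₁ (λ (lift x∈Q) → x∉Q x∈Q)
          ... | yes x∈Q = inj₂ (lift (⇨-modus-ponens (filter Q) x y (P⊆Q _ x⇨y∈P) x∈Q))

      backward : (h x ⇒S h y) P → h (x ⇨ y) P
      backward (P₀ , above-P₀ , lift P₀⊆P) = lift (P₀⊆P _ (by-contradiction λ x⇨y∉P₀ →
        let (Q , P₀⊆Q , x∈Q , y∉Q) = separate-⇨ (filter P₀) x y x⇨y∉P₀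
        in [ (λ x∉Q → x∉Q (lift x∈Q)) , (λ (lift y∈Q) → y∉Q y∈Q) ]
             (above-P₀ Q (lift P₀⊆Q))))

  ⇒S-congʳ : ∀ G {K L} → K ≐ L → (G ⇒S K) ≐ (G ⇒S L)
  ⇒S-congʳ G K≐L P =
    (λ (P₀ , above , r) → P₀ , (λ Q rQ → ⊎-map (λ n → n) (proj₁ (K≐L Q)) (above Q rQ)) , r) ,
    (λ (P₀ , above , r) → P₀ , (λ Q rQ → ⊎-map (λ n → n) (proj₂ (K≐L Q)) (above Q rQ)) , r)

  ≐-trans : ∀ {X Y Z} → X ≐ Y → Y ≐ Z → X ≐ Z
  ≐-trans X≐Y Y≐Z P = (λ x → proj₁ (Y≐Z P) (proj₁ (X≐Y P) x)) ,
                      (λ z → proj₂ (X≐Y P) (proj₂ (Y≐Z P) z))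

  h-¬ : ∀ x → h (¬ₕ x) ≐ (¬S (h x))
  h-¬ x = ≐-trans (h-⇨ x 𝟘) (⇒S-congʳ (h x) h-𝟘)

  φ-intro : (P : Ob) → ∀ z → ¬ pred P (∼ z) → φ-pred P z
  φ-intro P z ∼z∉P (p , p∈P , z≈∼p) =
    ∼z∉P (∈-resp-≈ P p∈P (Eq.trans (Eq.sym (∼∼ p)) (∼-cong (Eq.sym z≈∼p))))

  φ-elim : (P : Ob) → ∀ z → φ-pred P z → ¬ pred P (∼ z)
  φ-elim P z z∈φP ∼z∈P = z∈φP (∼ z , ∼z∈P , Eq.sym (∼∼ z))

  φ-isPrimeFilter : (P : Ob) → IsPrimeFilter (φ-pred P)
  φ-isPrimeFilter P = record
    { has-𝟙    = φ-intro P 𝟙 (λ ∼𝟙∈P → 𝟘∉ P (up-close _ 𝟘 ∼𝟙∈P ∼𝟙≤𝟘))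
    ; up-close = λ x y x∈φP x≤y → φ-intro P y (λ ∼y∈P →
        φ-elim P x x∈φP (up-close _ _ ∼y∈P (∼-antitone x≤y)))
    ; ∧-close  = λ x y x∈φP y∈φP → φ-intro P (x ∧ y) (λ ∼x∧y∈P →
        [ φ-elim P x x∈φP , φ-elim P y y∈φP ]
          (prime _ _ (up-close _ _ ∼x∧y∈P (reflexive (∼-∧ x y)))))
    ; proper   = λ all → φ-elim P 𝟘 (all 𝟘) (up-close 𝟙 _ has-𝟙 𝟙≤∼𝟘)
    ; prime    = λ x y x∨y∈φP → by-contradiction λ x,y∉φP →
        φ-elim P _ x∨y∈φP (up-close _ _
          (∧-close _ _ (by-contradiction λ ∼x∉P → x,y∉φP (inj₁ (φ-intro P x ∼x∉P)))
                       (by-contradiction λ ∼y∉P → x,y∉φP (inj₂ (φ-intro P y ∼y∉P))))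
          (∼∧∼≤∼∨ x y)) }
    where open IsPrimeFilter (isPF P)

  φ : Ob → Ob
  φ P = mkOb (φ-pred P) (φ-isPrimeFilter P)

  -- φ is an involution: z ∈ φ(φ(P)) iff ¬¬(∼∼z ∈ P) iff z ∈ P.
  φ-involutive : (P : Ob) → ∀ z → (pred P z → φ-pred (φ P) z) × (φ-pred (φ P) z → pred P z)
  φ-involutive P z =
    (λ z∈P → φ-intro (φ P) z (λ ∼z∈φP → φ-elim P (∼ z) ∼z∈φP (∈-resp-≈ P z∈P (Eq.sym (∼∼ z))))) ,
    (λ z∈φφP → by-contradiction λ z∉P →
       φ-elim (φ P) z z∈φφP (φ-intro P (∼ z) (λ ∼∼z∈P → z∉P (∈-resp-≈ P ∼∼z∈P (∼∼ z)))))

  h-∼ : ∀ x → h (∼ x) ≐ (∼S (h x))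
  h-∼ x P = forward , backward
    where
      forward : h (∼ x) P → (∼S (h x)) P
      forward (lift ∼x∈P) (P' , lift x∈P' , P≐φP') =
        φ-elim P' (∼ x) (proj₁ (P≐φP' (∼ x)) ∼x∈P) (∈-resp-≈ P' x∈P' (Eq.sym (∼∼ x)))

      backward : (∼S (h x)) P → h (∼ x) P
      backward P∉φhx = lift (by-contradiction λ ∼x∉P →
        P∉φhx (φ P , lift (φ-intro P x ∼x∉P) , φ-involutive P))

  representable : Representable
  representable = h , h-open , h-injective , h-𝟘 , h-𝟙 , h-∧ , h-∨ , h-⇨ , h-¬ , h-∼

theorem3p5 : ∀ {c ℓ₁ ℓ₂ : Level} →
    ExcludedMiddle (suc (c ⊔ ℓ₁ ⊔ ℓ₂)) →
    Zorn (suc (c ⊔ ℓ₁ ⊔ ℓ₂)) →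
    (A : SymHeytingAlgebra c ℓ₁ ℓ₂) →
    Representation.Representable A
theorem3p5 em zorn A = Representation-Theorem.representable A em zorn
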